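{- Let $\ell\ge 0$ and $k\ge 1$ be integers. Every covered $\ell$-bounded hypergraph $\mathcal{H}$ with at least $\sum_{l=0}^{\ell}(k-1)^l$ vertices satisfies $\alpha(\mathcal{H})\ge k$. Equivalently, $F(\ell,k)\le\sum_{l=0}^{\ell}(k-1)^l$.
   Context: A hypergraph $\mathcal{H}=(V,E)$ is a finite set $V$ together with a set $E$ of subsets of $V$. It is covered if every $v\in V$ lies in some $e\in E$, and $\ell$-bounded if $|e|\le\ell$ for all $e\in E$. For $A,B\subseteq V$, $(A,B)$ is an induced pair of order $k$ if $|B|=k$, for each $b\in B$ there is $e\in E$ with $A\cup\{b\}\subseteq e$, and there is no $e\in E$ with $e\supseteq A$ and $|e\cap B|>1$. $\alpha(\mathcal{H})$ is the maximum $k$ such that $\mathcal{H}$ has an induced pair of order $k$. $F(\ell,k)$ is the minimum $n$ such that every covered $\ell$-bounded hypergraph on at least $n$ vertices has $\alpha(\mathcal{H})\ge k$. Here $0^0=1$. -}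

module Defs where

open import Data.Nat using (ℕ; zero; suc; _+_; _∸_; _^_; _≤_; _<_)
open import Data.Fin using (Fin)
open import Data.Fin.Subset using (Subset; _∈_; _⊆_; _∩_; ∣_∣)
open import Data.List using (List)
import Data.List.Membership.Propositional as LM
open import Data.Product using (Σ; _×_; ∃)
open import Relation.Binary.PropositionalEquality using (_≡_)
open import Relation.Nullary using (¬_)

record Hypergraph (n : ℕ) : Set where
  constructor hypergraph
  field
    edges : List (Subset n)

open Hypergraph public

_∈E_ : ∀ {n} → Subset n → Hypergraph n → Set
e ∈E H = e LM.∈ edges H

Covered : ∀ {n} → Hypergraph n → Set
Covered {n} H = (v : Fin n) → Σ (Subset n) λ e → e ∈E H × v ∈ e

Bounded : ∀ {n} → ℕ → Hypergraph n → Set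
Bounded ℓ H = ∀ e → e ∈E H → ∣ e ∣ ≤ ℓ

InducedPair : ∀ {n} → Hypergraph n → ℕ → Subset n → Subset n → Set
InducedPair {n} H k A B =
  (∣ B ∣ ≡ k)
  × ((b : Fin n) → b ∈ B → Σ (Subset n) λ e → e ∈E H × A ⊆ e × b ∈ e)
  × ¬ (Σ (Subset n) λ e → e ∈E H × A ⊆ e × 1 < ∣ e ∩ B ∣)

HasInducedPair : ∀ {n} → Hypergraph n → ℕ → Set
HasInducedPair {n} H k = Σ (Subset n) λ A → Σ (Subset n) λ B → InducedPair H k A B

αAtLeast : ∀ {n} → Hypergraph n → ℕ → Set
αAtLeast H k = ∃ λ k′ → k ≤ k′ × HasInducedPair H k′

-- geomSum ℓ x = Σ_{l=0}^{ℓ} x^l   (with 0^0 = 1, as in ℕ's _^_)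
geomSum : ℕ → ℕ → ℕ
geomSum zero    x = x ^ 0
geomSum (suc ℓ) x = geomSum ℓ x + x ^ suc ℓ

-- Grow a set A lying in edges, keeping track of its link: the vertices outside A that
-- share an edge with A.  A maximal list B of link vertices, no two of which lie in a
-- common edge through A, gives the induced pair (A, B).  If |B| < k, every link vertex
-- lies in {b} ∪ link (A ∪ {b}) for some b ∈ B; as |link A| ≥ 1 + (k - 1) Σ_{l<ℓ} (k - 1)^l,
-- some link (A ∪ {b}) has Σ_{l<ℓ} (k - 1)^l vertices, while edges through A ∪ {b} have
-- one vertex fewer outside it, so induction on ℓ applies.
module Submission where

open import Defs
open import Data.Nat using (ℕ; zero; suc; _+_; _*_; _^_; _∸_; _≤_; _<_; z≤n; s≤s; _≤?_)
open import Data.Nat.Properties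
  using (≤-trans; ≤-reflexive; ≤-pred; +-suc; +-monoʳ-≤; +-mono-≤; n≤1+n; *-monoˡ-≤; *-distribˡ-+; ≰⇒>; ≤⇒≯; n≮n; module ≤-Reasoning)
open import Data.Fin using (Fin; zero; suc; _≟_)
open import Data.Fin.Subset
open import Data.Fin.Subset.Properties
open import Data.Vec using ([]; _∷_; here; there; tabulate)
open import Data.Vec.Properties using (lookup⇒[]=; []=⇒lookup; lookup∘tabulate)
open import Data.List using (List; []; _∷_; length; map; allFin)
open import Data.List.Properties using (length-map)
open import Data.List.Membership.Propositional as List using (find; lose)
open import Data.List.Membership.Propositional.Properties using (∈-allFin)
open import Data.List.Relation.Binary.Subset.Propositional using () renaming (_⊆_ to _⊆ₗ_)
open import Data.List.Relation.Binary.Subset.Propositional.Properties using (Any-resp-⊆)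
open import Data.List.Relation.Unary.Any using (Any; here; there; any?)
import Data.List.Relation.Unary.Any as Any
import Data.List.Relation.Unary.Any.Properties as Any
open import Data.List.Relation.Unary.All as All using (All; []; _∷_)
import Data.List.Relation.Unary.All.Properties as All
open import Data.List.Relation.Unary.AllPairs using (AllPairs; []; _∷_)
open import Data.List.Relation.Unary.Unique.Propositional using (Unique)
open import Data.Product using (Σ; _×_; _,_; ∃-syntax; proj₁; proj₂)
open import Data.Sum using (_⊎_; inj₁; inj₂)
open import Data.Empty using (⊥-elim)
open import Function using (_∘_)
open import Relation.Nullary using (¬_; Dec; yes; no; does; contradiction)
open import Relation.Nullary.Decidable using (_×-dec_; ¬?; map′; dec-true)
open import Relation.Unary using (Decidable)
open import Relation.Binary.PropositionalEquality using (_≡_; _≢_; refl; sym; trans; cong; subst)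

private
  variable
    m : ℕ
    x : Fin m

∣p∪q∣≤∣p∣+∣q∣ : (p q : Subset m) → ∣ p ∪ q ∣ ≤ ∣ p ∣ + ∣ q ∣
∣p∪q∣≤∣p∣+∣q∣ []            []            = z≤n
∣p∪q∣≤∣p∣+∣q∣ (outside ∷ p) (outside ∷ q) = ∣p∪q∣≤∣p∣+∣q∣ p q
∣p∪q∣≤∣p∣+∣q∣ (outside ∷ p) (inside  ∷ q) =
  ≤-trans (s≤s (∣p∪q∣≤∣p∣+∣q∣ p q)) (≤-reflexive (sym (+-suc ∣ p ∣ ∣ q ∣)))
∣p∪q∣≤∣p∣+∣q∣ (inside  ∷ p) (outside ∷ q) = s≤s (∣p∪q∣≤∣p∣+∣q∣ p q)
∣p∪q∣≤∣p∣+∣q∣ (inside  ∷ p) (inside  ∷ q) =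
  s≤s (≤-trans (∣p∪q∣≤∣p∣+∣q∣ p q) (+-monoʳ-≤ ∣ p ∣ (n≤1+n ∣ q ∣)))

x∉p⇒∣⁅x⁆∪p∣≡1+∣p∣ : (x : Fin m) (p : Subset m) → x ∉ p → ∣ ⁅ x ⁆ ∪ p ∣ ≡ suc ∣ p ∣
x∉p⇒∣⁅x⁆∪p∣≡1+∣p∣ zero    (inside  ∷ p) x∉p = contradiction here x∉p
x∉p⇒∣⁅x⁆∪p∣≡1+∣p∣ zero    (outside ∷ p) x∉p = cong (suc ∘ ∣_∣) (∪-identityˡ p)
x∉p⇒∣⁅x⁆∪p∣≡1+∣p∣ (suc x) (inside  ∷ p) x∉p = cong suc (x∉p⇒∣⁅x⁆∪p∣≡1+∣p∣ x p (drop-not-there x∉p))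
x∉p⇒∣⁅x⁆∪p∣≡1+∣p∣ (suc x) (outside ∷ p) x∉p = x∉p⇒∣⁅x⁆∪p∣≡1+∣p∣ x p (drop-not-there x∉p)

∣p∣≤1 : (p : Subset m) → (∀ {x y} → x ∈ p → y ∈ p → x ≡ y) → ∣ p ∣ ≤ 1
∣p∣≤1 {m} p unique with nonempty? p
... | no  empty = ≤-trans (≤-reflexive (trans (cong ∣_∣ (Empty-unique empty)) (∣⊥∣≡0 m))) z≤n
... | yes (x , x∈p) = ≤-trans (p⊆q⇒∣p∣≤∣q∣ p⊆⁅x⁆) (≤-reflexive (∣⁅x⁆∣≡1 x))
  where
  p⊆⁅x⁆ : p ⊆ ⁅ x ⁆
  p⊆⁅x⁆ y∈p = subst (_∈ ⁅ x ⁆) (unique x∈p y∈p) (x∈⁅x⁆ x)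

x∈⋃⁺ : {ps : List (Subset m)} → Any (x ∈_) ps → x ∈ ⋃ ps
x∈⋃⁺ {ps = p ∷ ps} (here x∈p)  = p⊆p∪q (⋃ ps) x∈p
x∈⋃⁺ {ps = p ∷ ps} (there x∈⋃) = q⊆p∪q p (⋃ ps) (x∈⋃⁺ x∈⋃)

x∈⋃⁻ : (ps : List (Subset m)) → x ∈ ⋃ ps → Any (x ∈_) ps
x∈⋃⁻ []       x∈⊥ = contradiction x∈⊥ ∉⊥
x∈⋃⁻ (p ∷ ps) x∈⋃ with x∈p∪q⁻ p (⋃ ps) x∈⋃
... | inj₁ x∈p = here x∈p
... | inj₂ x∈⋃ps = there (x∈⋃⁻ ps x∈⋃ps)

∣⋃∣≤length* : ∀ {c} {ps : List (Subset m)} → All (λ p → ∣ p ∣ ≤ c) ps → ∣ ⋃ ps ∣ ≤ length ps * c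
∣⋃∣≤length* {m} []                     = ≤-reflexive (∣⊥∣≡0 m)
∣⋃∣≤length* {ps = p ∷ ps} (p≤ ∷ ps≤) =
  ≤-trans (∣p∪q∣≤∣p∣+∣q∣ p (⋃ ps)) (+-mono-≤ p≤ (∣⋃∣≤length* ps≤))

subsetOf : {P : Fin m → Set} → Decidable P → Subset m
subsetOf P? = tabulate (does ∘ P?)

module _ {P : Fin m → Set} (P? : Decidable P) where

  ∈subsetOf⁺ : P x → x ∈ subsetOf P?
  ∈subsetOf⁺ {x} px = lookup⇒[]= x _ (trans (lookup∘tabulate _ x) (dec-true (P? x) px))

  ∈subsetOf⁻ : x ∈ subsetOf P? → P x
  ∈subsetOf⁻ {x} x∈ with P? x | trans (sym (lookup∘tabulate (does ∘ P?) x)) ([]=⇒lookup x∈)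
  ... | yes px | _ = px
  ... | no  _  | ()

fromList : List (Fin m) → Subset m
fromList xs = ⋃ (map ⁅_⁆ xs)

∈fromList⁻ : (xs : List (Fin m)) → x ∈ fromList xs → x List.∈ xs
∈fromList⁻ xs x∈ = Any.map (λ {y} → x∈⁅y⁆⇒x≡y y) (Any.map⁻ (x∈⋃⁻ (map ⁅_⁆ xs) x∈))

∣fromList∣≡length : {xs : List (Fin m)} → Unique xs → ∣ fromList xs ∣ ≡ length xs
∣fromList∣≡length {m} {xs = []} [] = ∣⊥∣≡0 m
∣fromList∣≡length {xs = x ∷ xs} (x∉ ∷ uxs) =
  trans (x∉p⇒∣⁅x⁆∪p∣≡1+∣p∣ x (fromList xs) x∉fromList) (cong suc (∣fromList∣≡length uxs))
  where
  x∉fromList : x ∉ fromList xs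
  x∉fromList = All.All¬⇒¬Any x∉ ∘ ∈fromList⁻ xs

allPairs-lookup : ∀ {A : Set} {R : A → A → Set} {xs a b} → AllPairs R xs →
  a List.∈ xs → b List.∈ xs → a ≢ b → R a b ⊎ R b a
allPairs-lookup (_   ∷ _)   (here refl) (here refl) a≢b = contradiction refl a≢b
allPairs-lookup (Rx ∷ _)    (here refl) (there b∈)  _   = inj₁ (All.lookup Rx b∈)
allPairs-lookup (Rx ∷ _)    (there a∈)  (here refl) _   = inj₂ (All.lookup Rx a∈)
allPairs-lookup (_  ∷ Rxs)  (there a∈)  (there b∈)  a≢b = allPairs-lookup Rxs a∈ b∈ a≢b

geomSum-suc : ∀ ℓ x → geomSum (suc ℓ) x ≡ suc (x * geomSum ℓ x)
geomSum-suc zero    x = refl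
geomSum-suc (suc ℓ) x = trans (cong (_+ x ^ suc (suc ℓ)) (geomSum-suc ℓ x))
  (cong suc (sym (*-distribˡ-+ x (geomSum ℓ x) (x ^ suc ℓ))))

module _ {n : ℕ} (H : Hypergraph n) where

  EdgeOver : Subset n → (Subset n → Set) → Set
  EdgeOver A P = Σ (Subset n) λ e → e ∈E H × A ⊆ e × P e

  edgeOver? : ∀ A {P : Subset n → Set} → Decidable P → Dec (EdgeOver A P)
  edgeOver? A {P} P? = map′ from to (any? (λ e → (A ⊆? e) ×-dec P? e) (edges H))
    where
    from : Any (λ e → A ⊆ e × P e) (edges H) → EdgeOver A P
    from any = let e , e∈H , A⊆e , pe = find any in e , e∈H , A⊆e , pe
    to : EdgeOver A P → Any (λ e → A ⊆ e × P e) (edges H)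
    to (e , e∈H , A⊆e , pe) = lose e∈H (A⊆e , pe)

  Joined : Subset n → Fin n → Fin n → Set
  Joined A u v = EdgeOver A (λ e → u ∈ e × v ∈ e)

  joined? : ∀ A u v → Dec (Joined A u v)
  joined? A u v = edgeOver? A (λ e → (u ∈? e) ×-dec (v ∈? e))

  InLink : Subset n → Fin n → Set
  InLink A v = v ∉ A × EdgeOver A (v ∈_)

  inLink? : ∀ A v → Dec (InLink A v)
  inLink? A v = ¬? (v ∈? A) ×-dec edgeOver? A (v ∈?_)

  link : Subset n → Subset n
  link A = subsetOf (inLink? A)

  covered⇒⊤⊆link-⊥ : Covered H → ⊤ ⊆ link ⊥
  covered⇒⊤⊆link-⊥ covered {v} _ =
    let e , e∈H , v∈e = covered v in ∈subsetOf⁺ (inLink? ⊥) (∉⊥ , e , e∈H , ⊥⊆ , v∈e)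

  joined-refl : ∀ {A v} → InLink A v → Joined A v v
  joined-refl (_ , e , e∈H , A⊆e , v∈e) = e , e∈H , A⊆e , v∈e , v∈e

  Independent : Subset n → List (Fin n) → Set
  Independent A bs = All (InLink A) bs × AllPairs (λ a b → ¬ Joined A a b) bs

  independent⇒unique : ∀ {A bs} → Independent A bs → Unique bs
  independent⇒unique ([] , []) = []
  independent⇒unique (inLink ∷ inLinks , unjoined ∷ unjoineds) =
    All.map (λ ¬joined b≡ → ¬joined (subst (Joined _ _) b≡ (joined-refl inLink))) unjoined
      ∷ independent⇒unique (inLinks , unjoineds)

  independent⇒inducedPair : ∀ {A bs} → Independent A bs → InducedPair H (length bs) A (fromList bs)
  independent⇒inducedPair {A} {bs} ind@(inLinks , unjoineds) =
    ∣fromList∣≡length (independent⇒unique ind) , overEdge , meetsOnce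
    where
    overEdge : ∀ b → b ∈ fromList bs → EdgeOver A (b ∈_)
    overEdge b b∈ = proj₂ (All.lookup inLinks (∈fromList⁻ bs b∈))

    meetsOnce : ¬ EdgeOver A (λ e → 1 < ∣ e ∩ fromList bs ∣)
    meetsOnce (e , e∈H , A⊆e , twice) = ≤⇒≯ (∣p∣≤1 (e ∩ fromList bs) same) twice
      where
      same : ∀ {a b} → a ∈ e ∩ fromList bs → b ∈ e ∩ fromList bs → a ≡ b
      same {a} {b} a∈ b∈ with x∈p∩q⁻ e _ a∈ | x∈p∩q⁻ e _ b∈ | a ≟ b
      ... | _ | _ | yes a≡b = a≡b
      ... | a∈e , a∈bs | b∈e , b∈bs | no a≢b
        with allPairs-lookup unjoineds (∈fromList⁻ bs a∈bs) (∈fromList⁻ bs b∈bs) a≢b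
      ...   | inj₁ ¬joined = ⊥-elim (¬joined (e , e∈H , A⊆e , a∈e , b∈e))
      ...   | inj₂ ¬joined = ⊥-elim (¬joined (e , e∈H , A⊆e , b∈e , a∈e))

  Dominates : Subset n → List (Fin n) → Fin n → Set
  Dominates A bs u = InLink A u → Any (Joined A u) bs

  extendGreedily : ∀ {A} (vs : List (Fin n)) {bs} → Independent A bs →
    ∃[ bs′ ] Independent A bs′ × bs ⊆ₗ bs′ × All (Dominates A bs′) vs
  extendGreedily []             ind = _ , ind , (λ b∈ → b∈) , []
  extendGreedily {A} (v ∷ vs) {bs} ind@(inLinks , unjoineds) with inLink? A v | any? (joined? A v) bs
  ... | no  v∉link | _ =
    let bs′ , ind′ , bs⊆ , dom = extendGreedily vs ind
    in  bs′ , ind′ , bs⊆ , (λ v∈link → contradiction v∈link v∉link) ∷ dom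
  ... | yes _ | yes joined =
    let bs′ , ind′ , bs⊆ , dom = extendGreedily vs ind
    in  bs′ , ind′ , bs⊆ , (λ _ → Any-resp-⊆ bs⊆ joined) ∷ dom
  ... | yes v∈link | no unjoined =
    let bs′ , ind′ , v∷bs⊆ , dom = extendGreedily vs (v∈link ∷ inLinks , All.¬Any⇒All¬ bs unjoined ∷ unjoineds)
    in  bs′ , ind′ , v∷bs⊆ ∘ there , (λ _ → Any-resp-⊆ v∷bs⊆ (here (joined-refl v∈link))) ∷ dom

  maximalIndependent : ∀ A → ∃[ bs ] Independent A bs × (∀ u → Dominates A bs u)
  maximalIndependent A =
    let bs , ind , _ , dom = extendGreedily (allFin n) ([] , []) in bs , ind , λ u → All.lookup dom (∈-allFin u)

  joined⇒∈⁅⁆∪link : ∀ {A u b} → InLink A u → Joined A u b → u ∈ ⁅ b ⁆ ∪ link (A ∪ ⁅ b ⁆)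
  joined⇒∈⁅⁆∪link {A} {u} {b} (u∉A , _) (e , e∈H , A⊆e , u∈e , b∈e) with u ≟ b
  ... | yes refl = p⊆p∪q _ (x∈⁅x⁆ u)
  ... | no  u≢b  = q⊆p∪q ⁅ b ⁆ _ (∈subsetOf⁺ (inLink? _) (u∉A∪b , e , e∈H , A∪b⊆e , u∈e))
    where
    u∉A∪b : u ∉ A ∪ ⁅ b ⁆
    u∉A∪b u∈ with x∈p∪q⁻ A ⁅ b ⁆ u∈
    ... | inj₁ u∈A = u∉A u∈A
    ... | inj₂ u∈b = u≢b (x∈⁅y⁆⇒x≡y b u∈b)
    A∪b⊆e : A ∪ ⁅ b ⁆ ⊆ e
    A∪b⊆e {y} y∈ with x∈p∪q⁻ A ⁅ b ⁆ y∈
    ... | inj₁ y∈A = A⊆e y∈A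
    ... | inj₂ y∈b = subst (_∈ e) (sym (x∈⁅y⁆⇒x≡y b y∈b)) b∈e

  link⊆⋃ : ∀ {A bs} → (∀ u → Dominates A bs u) →
    link A ⊆ ⋃ (map (λ b → ⁅ b ⁆ ∪ link (A ∪ ⁅ b ⁆)) bs)
  link⊆⋃ {A} dominated {u} u∈link =
    x∈⋃⁺ (Any.map⁺ (Any.map (joined⇒∈⁅⁆∪link inLink) (dominated u inLink)))
    where
    inLink : InLink A u
    inLink = ∈subsetOf⁻ (inLink? A) u∈link

  BoundedOver : ℕ → Subset n → Set
  BoundedOver ℓ A = ∀ e → e ∈E H → A ⊆ e → ∣ e ─ A ∣ ≤ ℓ

  bounded⇒boundedOver-⊥ : ∀ {ℓ} → Bounded ℓ H → BoundedOver ℓ ⊥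
  bounded⇒boundedOver-⊥ bounded e e∈H _ = subst (_≤ _) (sym (cong ∣_∣ (p─⊥≡p e))) (bounded e e∈H)

  boundedOver-∪⁅⁆ : ∀ {ℓ A b} → b ∉ A → BoundedOver (suc ℓ) A → BoundedOver ℓ (A ∪ ⁅ b ⁆)
  boundedOver-∪⁅⁆ {ℓ} {A} {b} b∉A bounded e e∈H A∪b⊆e = ≤-pred (begin-strict
    ∣ e ─ (A ∪ ⁅ b ⁆) ∣ ≡⟨ cong ∣_∣ (p─q─r≡p─q∪r e A ⁅ b ⁆) ⟨
    ∣ e ─ A - b ∣       <⟨ x∈p⇒∣p-x∣<∣p∣ (x∈p∧x∉q⇒x∈p─q (A∪b⊆e (q⊆p∪q A _ (x∈⁅x⁆ b))) b∉A) ⟩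
    ∣ e ─ A ∣           ≤⟨ bounded e e∈H (A∪b⊆e ∘ p⊆p∪q _) ⟩
    suc ℓ               ∎)
    where open ≤-Reasoning

  boundedOver-zero⇒∣link∣≡0 : ∀ {A} → BoundedOver 0 A → ∣ link A ∣ ≡ 0
  boundedOver-zero⇒∣link∣≡0 {A} bounded =
    trans (cong ∣_∣ (Empty-unique empty)) (∣⊥∣≡0 n)
    where
    empty : Empty (link A)
    empty (v , v∈link) with ∈subsetOf⁻ (inLink? A) v∈link
    ... | v∉A , e , e∈H , A⊆e , v∈e =
      n≮n 0 (≤-trans (s≤s z≤n) (≤-trans (x∈p⇒∣p-x∣<∣p∣ (x∈p∧x∉q⇒x∈p─q v∈e v∉A)) (bounded e e∈H A⊆e)))

  richNeighbour : ∀ {A bs} ℓ x → (∀ u → Dominates A bs u) → length bs ≤ x →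
    geomSum (suc ℓ) x ≤ ∣ link A ∣ → Any (λ b → geomSum ℓ x ≤ ∣ link (A ∪ ⁅ b ⁆) ∣) bs
  richNeighbour {A} {bs} ℓ x dominated length≤x large
    with any? (λ b → geomSum ℓ x ≤? ∣ link (A ∪ ⁅ b ⁆) ∣) bs
  ... | yes rich = rich
  ... | no  poor = contradiction (subst (_≤ ∣ link A ∣) (geomSum-suc ℓ x) large) (≤⇒≯ linkSmall)
    where
    open ≤-Reasoning

    G : ℕ
    G = geomSum ℓ x

    star : Fin n → Subset n
    star b = ⁅ b ⁆ ∪ link (A ∪ ⁅ b ⁆)

    starSmall : ∀ {b} → ¬ G ≤ ∣ link (A ∪ ⁅ b ⁆) ∣ → ∣ star b ∣ ≤ G
    starSmall {b} ¬large = begin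
      ∣ star b ∣                         ≤⟨ ∣p∪q∣≤∣p∣+∣q∣ ⁅ b ⁆ _ ⟩
      ∣ ⁅ b ⁆ ∣ + ∣ link (A ∪ ⁅ b ⁆) ∣   ≡⟨ cong (_+ ∣ link (A ∪ ⁅ b ⁆) ∣) (∣⁅x⁆∣≡1 b) ⟩
      suc ∣ link (A ∪ ⁅ b ⁆) ∣           ≤⟨ ≰⇒> ¬large ⟩
      G                                  ∎

    linkSmall : ∣ link A ∣ ≤ x * G
    linkSmall = begin
      ∣ link A ∣                 ≤⟨ p⊆q⇒∣p∣≤∣q∣ (link⊆⋃ dominated) ⟩
      ∣ ⋃ (map star bs) ∣        ≤⟨ ∣⋃∣≤length* (All.map⁺ (All.map starSmall (All.¬Any⇒All¬ bs poor))) ⟩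
      length (map star bs) * G   ≡⟨ cong (_* G) (length-map star bs) ⟩
      length bs * G              ≤⟨ *-monoˡ-≤ G length≤x ⟩
      x * G                      ∎

  largeLink⇒α : ∀ x ℓ {A} → BoundedOver ℓ A → geomSum ℓ x ≤ ∣ link A ∣ → αAtLeast H (suc x)
  largeLink⇒α x zero    {A} bounded large =
    contradiction (subst (1 ≤_) (boundedOver-zero⇒∣link∣≡0 bounded) large) λ ()
  largeLink⇒α x (suc ℓ) {A} bounded large with maximalIndependent A
  ... | bs , ind , dominated with suc x ≤? length bs
  ...   | yes k≤ = length bs , k≤ , A , fromList bs , independent⇒inducedPair ind
  ...   | no  k≰ with find (richNeighbour ℓ x dominated (≤-pred (≰⇒> k≰)) large)
  ...     | b , b∈bs , rich =
    largeLink⇒α x ℓ (boundedOver-∪⁅⁆ (proj₁ (All.lookup (proj₁ ind) b∈bs)) bounded) rich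

lemma4p1 : (ℓ k : ℕ) → 1 ≤ k → (n : ℕ) → (H : Hypergraph n) →
    Covered H → Bounded ℓ H → geomSum ℓ (k ∸ 1) ≤ n → αAtLeast H k
lemma4p1 ℓ zero    () n H
lemma4p1 ℓ (suc x) _  n H covered bounded size =
  largeLink⇒α H x ℓ (bounded⇒boundedOver-⊥ H bounded) (begin
    geomSum ℓ x   ≤⟨ size ⟩
    n             ≡⟨ ∣⊤∣≡n n ⟨
    ∣ ⊤ {n} ∣     ≤⟨ p⊆q⇒∣p∣≤∣q∣ (covered⇒⊤⊆link-⊥ H covered) ⟩
    ∣ link H ⊥ ∣  ∎)
  where open ≤-Reasoning
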